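{- Let $(\Gamma,\Delta)$, $(\Gamma_0,\Delta_0)$, $(\Gamma_1,\Delta_1)$ be maximal pairs and $\phi,\psi\in\mathcal{L}$. Then: (1) if $\Gamma\vdash\phi$ then $\phi\in\Gamma$; (2) $\phi\wedge\psi\in\Gamma$ iff $\phi,\psi\in\Gamma$; (3) $\phi\vee\psi\in\Gamma$ iff $\phi\in\Gamma$ or $\psi\in\Gamma$; (4) if $\phi\to\psi,\phi\in\Gamma$ then $\psi\in\Gamma$; (5) if $\Gamma_0\subseteq\Gamma$, $\{\psi\mid\phi\mathbin{\Box\!\!\to}\psi\in\Gamma_0\}\subseteq\Gamma_1$ and $\{\phi\mathbin{\Diamond\!\!\to}\psi\mid\psi\in\Gamma_1\}\subseteq\Gamma_0$, then $(\Gamma_1\cup\{\psi\mid\phi\mathbin{\Box\!\!\to}\psi\in\Gamma\},\{\psi\mid\phi\mathbin{\Diamond\!\!\to}\psi\in\Delta\})$ is consistent; (6) if $\Gamma_1\subseteq\Gamma$, $\{\psi\mid\phi\mathbin{\Box\!\!\to}\psi\in\Gamma_0\}\subseteq\Gamma_1$ and $\{\phi\mathbin{\Diamond\!\!\to}\psi\mid\psi\in\Gamma_1\}\subseteq\Gamma_0$, then $(\Gamma_0\cup\{\phi\mathbin{\Diamond\!\!\to}\psi\mid\psi\in\Gamma\},\{\phi\mathbin{\Box\!\!\to}\psi\mid\psi\in\Delta\})$ is consistent.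
   Context: $\mathcal{L}$ is built from propositional variables and $\top,\bot$ by $\wedge,\vee,\to$ and connectives $\phi\mathbin{\Box\!\!\to}\psi$, $\phi\mathbin{\Diamond\!\!\to}\psi$; $\neg\phi:=\phi\to\bot$. The Hilbert system $\mathbb{ICK}$ has axioms: (A0) all $\mathcal{L}$-instances of a complete axiomatization of intuitionistic propositional logic; (A1) $((\phi\mathbin{\Box\!\!\to}\psi)\wedge(\phi\mathbin{\Box\!\!\to}\chi))\leftrightarrow(\phi\mathbin{\Box\!\!\to}(\psi\wedge\chi))$; (A2) $((\phi\mathbin{\Diamond\!\!\to}\psi)\wedge(\phi\mathbin{\Box\!\!\to}\chi))\to(\phi\mathbin{\Diamond\!\!\to}(\psi\wedge\chi))$; (A3) $(\phi\mathbin{\Diamond\!\!\to}(\psi\vee\chi))\leftrightarrow((\phi\mathbin{\Diamond\!\!\to}\psi)\vee(\phi\mathbin{\Diamond\!\!\to}\chi))$; (A4) $((\phi\mathbin{\Diamond\!\!\to}\psi)\to(\phi\mathbin{\Box\!\!\to}\chi))\to(\phi\mathbin{\Box\!\!\to}(\psi\to\chi))$; (A5) $\phi\mathbin{\Box\!\!\to}\top$; (A6) $\neg(\phi\mathbin{\Diamond\!\!\to}\bot)$; rules: modus ponens; from $\phi\leftrightarrow\psi$ infer $(\phi\mathbin{\Box\!\!\to}\chi)\leftrightarrow(\psi\mathbin{\Box\!\!\to}\chi)$ and $(\chi\mathbin{\Box\!\!\to}\phi)\leftrightarrow(\chi\mathbin{\Box\!\!\to}\psi)$; and the same two with $\mathbin{\Diamond\!\!\to}$.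 $\Gamma\vdash\psi$ iff there is a finite sequence ending in $\psi$ each member of which is in $\Gamma$, a theorem of $\mathbb{ICK}$, or obtained from earlier members by modus ponens. A pair $(\Gamma,\Delta)$ of sets of formulas is consistent iff there is no finite $\Delta'\subseteq\Delta$ with $\Gamma\vdash\bigvee\Delta'$ ($\bigvee\emptyset=\bot$); complete iff $\Gamma\cup\Delta=\mathcal{L}$; maximal iff complete and consistent. -}

module Defs where

open import Data.Nat using (ℕ)
open import Data.List using (List; []; _∷_)
open import Data.List.Relation.Unary.All using (All)
open import Data.Product using (_×_; Σ-syntax)
open import Data.Sum using (_⊎_)
open import Relation.Nullary using (¬_)
open import Level using (0ℓ)
open import Relation.Unary using (Pred; _∈_; _⊆_; _∪_)

infixr 6 _∧'_
infixr 5 _∨'_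
infixr 4 _⇒_ _□→_ _◇→_
data Formula : Set where
  var  : ℕ → Formula
  ⊤'   : Formula
  ⊥'   : Formula
  _∧'_ : Formula → Formula → Formula
  _∨'_ : Formula → Formula → Formula
  _⇒_  : Formula → Formula → Formula
  _□→_ : Formula → Formula → Formula
  _◇→_ : Formula → Formula → Formula

¬' : Formula → Formula
¬' φ = φ ⇒ ⊥'

_⇔_ : Formula → Formula → Formula
φ ⇔ ψ = (φ ⇒ ψ) ∧' (ψ ⇒ φ)

-- Theorems of ICK.  (A0) is instantiated with the standard complete Hilbert
-- axiomatization of intuitionistic propositional logic (K, S, ∧/∨ axioms, ex falso, ⊤).
data Thm : Formula → Set where
  ax-K    : ∀ φ ψ → Thm (φ ⇒ (ψ ⇒ φ))
  ax-S    : ∀ φ ψ χ → Thm ((φ ⇒ (ψ ⇒ χ)) ⇒ ((φ ⇒ ψ) ⇒ (φ ⇒ χ)))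
  ax-∧I   : ∀ φ ψ → Thm (φ ⇒ (ψ ⇒ (φ ∧' ψ)))
  ax-∧E₁  : ∀ φ ψ → Thm ((φ ∧' ψ) ⇒ φ)
  ax-∧E₂  : ∀ φ ψ → Thm ((φ ∧' ψ) ⇒ ψ)
  ax-∨I₁  : ∀ φ ψ → Thm (φ ⇒ (φ ∨' ψ))
  ax-∨I₂  : ∀ φ ψ → Thm (ψ ⇒ (φ ∨' ψ))
  ax-∨E   : ∀ φ ψ χ → Thm ((φ ⇒ χ) ⇒ ((ψ ⇒ χ) ⇒ ((φ ∨' ψ) ⇒ χ)))
  ax-⊥E   : ∀ φ → Thm (⊥' ⇒ φ)
  ax-⊤    : Thm ⊤'
  ax-A1   : ∀ φ ψ χ → Thm (((φ □→ ψ) ∧' (φ □→ χ)) ⇔ (φ □→ (ψ ∧' χ)))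
  ax-A2   : ∀ φ ψ χ → Thm (((φ ◇→ ψ) ∧' (φ □→ χ)) ⇒ (φ ◇→ (ψ ∧' χ)))
  ax-A3   : ∀ φ ψ χ → Thm ((φ ◇→ (ψ ∨' χ)) ⇔ ((φ ◇→ ψ) ∨' (φ ◇→ χ)))
  ax-A4   : ∀ φ ψ χ → Thm (((φ ◇→ ψ) ⇒ (φ □→ χ)) ⇒ (φ □→ (ψ ⇒ χ)))
  ax-A5   : ∀ φ → Thm (φ □→ ⊤')
  ax-A6   : ∀ φ → Thm (¬' (φ ◇→ ⊥'))
  mp      : ∀ {φ ψ} → Thm (φ ⇒ ψ) → Thm φ → Thm ψ
  r□ˡ     : ∀ {φ ψ} χ → Thm (φ ⇔ ψ) → Thm ((φ □→ χ) ⇔ (ψ □→ χ))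
  r□ʳ     : ∀ {φ ψ} χ → Thm (φ ⇔ ψ) → Thm ((χ □→ φ) ⇔ (χ □→ ψ))
  r◇ˡ     : ∀ {φ ψ} χ → Thm (φ ⇔ ψ) → Thm ((φ ◇→ χ) ⇔ (ψ ◇→ χ))
  r◇ʳ     : ∀ {φ ψ} χ → Thm (φ ⇔ ψ) → Thm ((χ ◇→ φ) ⇔ (χ ◇→ ψ))

Theory : Set₁
Theory = Pred Formula 0ℓ

-- Γ ⊢ ψ : derivable from members of Γ and theorems of ICK by modus ponens
-- (inductive rendering of "finite sequence" derivations).
infix 2 _⊢_
data _⊢_ (Γ : Theory) : Formula → Set where
  assum : ∀ {φ} → φ ∈ Γ → Γ ⊢ φ
  thm   : ∀ {φ} → Thm φ → Γ ⊢ φ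
  mp    : ∀ {φ ψ} → Γ ⊢ (φ ⇒ ψ) → Γ ⊢ φ → Γ ⊢ ψ

⋁ : List Formula → Formula
⋁ []       = ⊥'
⋁ (φ ∷ []) = φ
⋁ (φ ∷ φs) = φ ∨' ⋁ φs

Consistent : Theory → Theory → Set
Consistent Γ Δ = ¬ (Σ[ Δ' ∈ List Formula ] (All (_∈ Δ) Δ' × (Γ ⊢ ⋁ Δ')))

Complete : Theory → Theory → Set
Complete Γ Δ = ∀ φ → φ ∈ Γ ⊎ φ ∈ Δ

Maximal : Theory → Theory → Set
Maximal Γ Δ = Complete Γ Δ × Consistent Γ Δ

BoxSet : Formula → Theory → Theory
BoxSet φ Γ ψ = (φ □→ ψ) ∈ Γ

DiaSet : Formula → Theory → Theory
DiaSet φ Γ ψ = (φ ◇→ ψ) ∈ Γ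

DiaImg : Formula → Theory → Theory
DiaImg φ Γ χ = Σ[ ψ ∈ Formula ] (ψ ∈ Γ × χ ≡ (φ ◇→ ψ))
  where open import Relation.Binary.PropositionalEquality using (_≡_)

BoxImg : Formula → Theory → Theory
BoxImg φ Γ χ = Σ[ ψ ∈ Formula ] (ψ ∈ Γ × χ ≡ (φ □→ ψ))
  where open import Relation.Binary.PropositionalEquality using (_≡_)

{-# OPTIONS --safe #-}
-- For (5) and (6), a derivation from Γ ∪ B uses only finitely many assumptions
-- from B, so it can be traded for one derivation of β ⇒ δ from Γ, where β is a
-- conjunction of members of B.  In (5) the conjuncts are boxed in Γ, hence so
-- is β (A1, A5); pushing β ⇒ ⋁ L from Γ₁ back to Γ with ◇→ and combining with
-- φ □→ β by A2 yields φ ◇→ ⋁ L ∈ Γ, which A3 and A6 turn into an inconsistency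
-- of (Γ, Δ).  In (6), β is implied by some φ ◇→ χ with χ ∈ Γ, and the boxed
-- disjuncts merge into φ □→ ⋁ ψs; A4 moves φ □→ (χ ⇒ ⋁ ψs) into Γ₀, hence via
-- Γ₁ into Γ, so Γ ⊢ ⋁ ψs with ψs ⊆ Δ.
module Submission where

open import Defs
open import Data.Product using (_×_; _,_; proj₁; proj₂; Σ-syntax)
open import Data.Sum using (_⊎_; inj₁; inj₂)
open import Data.List using (List; []; _∷_; map)
open import Data.List.Relation.Unary.All using (All; []; _∷_)
open import Data.Empty using (⊥)
open import Relation.Unary using (_∈_; _∉_; _⊆_; _∪_)
open import Relation.Binary.PropositionalEquality using (_≡_; refl)

private
  variable
    Γ Δ Γ₀ Δ₀ Γ₁ Δ₁ : Theory
    a b c h φ : Formula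
    L : List Formula

∅ : Theory
∅ _ = ⊥

∅⊢⇒Thm : ∅ ⊢ a → Thm a
∅⊢⇒Thm (assum ())
∅⊢⇒Thm (thm t)  = t
∅⊢⇒Thm (mp p q) = mp (∅⊢⇒Thm p) (∅⊢⇒Thm q)

⇒-refl : Γ ⊢ a ⇒ a
⇒-refl {a = a} = mp (mp (thm (ax-S a (a ⇒ a) a)) (thm (ax-K a (a ⇒ a)))) (thm (ax-K a a))

⇒-const : Γ ⊢ b → Γ ⊢ a ⇒ b
⇒-const = mp (thm (ax-K _ _))

⇒-mp : Γ ⊢ h ⇒ (a ⇒ b) → Γ ⊢ h ⇒ a → Γ ⊢ h ⇒ b
⇒-mp p = mp (mp (thm (ax-S _ _ _)) p)

⇒-trans : Γ ⊢ a ⇒ b → Γ ⊢ b ⇒ c → Γ ⊢ a ⇒ c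
⇒-trans p q = ⇒-mp (⇒-const q) p

∧-intro : Γ ⊢ a → Γ ⊢ b → Γ ⊢ a ∧' b
∧-intro p = mp (mp (thm (ax-∧I _ _)) p)

⇒-∧-intro : Γ ⊢ h ⇒ a → Γ ⊢ h ⇒ b → Γ ⊢ h ⇒ (a ∧' b)
⇒-∧-intro p q = ⇒-mp (⇒-mp (⇒-const (thm (ax-∧I _ _))) p) q

∧-elimˡ : Γ ⊢ (a ∧' b) ⇒ a
∧-elimˡ = thm (ax-∧E₁ _ _)

∧-elimʳ : Γ ⊢ (a ∧' b) ⇒ b
∧-elimʳ = thm (ax-∧E₂ _ _)

∨-elim : Γ ⊢ a ⇒ c → Γ ⊢ b ⇒ c → Γ ⊢ (a ∨' b) ⇒ c
∨-elim p = mp (mp (thm (ax-∨E _ _ _)) p)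

⇔-to : Γ ⊢ a ⇔ b → Γ ⊢ a ⇒ b
⇔-to = mp ∧-elimˡ

⇔-from : Γ ⊢ a ⇔ b → Γ ⊢ b ⇒ a
⇔-from = mp ∧-elimʳ

-- a ∨ b ⇔ b and a ⇔ a ∧ b turn an implication into equivalences that the
-- congruence rules can carry under ◇→ and □→.
◇→-mono : Thm (a ⇒ b) → Γ ⊢ (φ ◇→ a) ⇒ (φ ◇→ b)
◇→-mono {a = a} {b = b} {φ = φ} a⇒b =
  ⇒-trans (thm (ax-∨I₁ _ _))
    (⇒-trans (⇔-from (thm (ax-A3 φ a b))) (⇔-to (thm (r◇ʳ φ a∨b⇔b))))
  where
    a∨b⇔b : Thm ((a ∨' b) ⇔ b)
    a∨b⇔b = ∅⊢⇒Thm (∧-intro (∨-elim (thm a⇒b) ⇒-refl) (thm (ax-∨I₂ _ _)))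

□→-mono : Thm (a ⇒ b) → Γ ⊢ (φ □→ a) ⇒ (φ □→ b)
□→-mono {a = a} {b = b} {φ = φ} a⇒b =
  ⇒-trans (⇔-to (thm (r□ʳ φ a⇔a∧b))) (⇒-trans (⇔-from (thm (ax-A1 φ a b))) ∧-elimʳ)
  where
    a⇔a∧b : Thm (a ⇔ (a ∧' b))
    a⇔a∧b = ∅⊢⇒Thm (∧-intro (⇒-∧-intro ⇒-refl (thm a⇒b)) ∧-elimˡ)

⋁-□→ : ∀ φ (ψs : List Formula) → Thm (⋁ (map (φ □→_) ψs) ⇒ (φ □→ ⋁ ψs))
⋁-□→ φ []           = ax-⊥E _
⋁-□→ φ (ψ ∷ [])     = ∅⊢⇒Thm ⇒-refl
⋁-□→ φ (ψ ∷ χ ∷ ψs) =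
  ∅⊢⇒Thm (∨-elim (□→-mono (ax-∨I₁ _ _)) (⇒-trans (thm (⋁-□→ φ (χ ∷ ψs))) (□→-mono (ax-∨I₂ _ _))))

All-BoxImg : All (BoxImg φ Δ) L →
  Σ[ ψs ∈ List Formula ] (All (_∈ Δ) ψs × L ≡ map (φ □→_) ψs)
All-BoxImg []                      = [] , [] , refl
All-BoxImg ((ψ , ψ∈Δ , refl) ∷ ps) with All-BoxImg ps
... | ψs , ψs⊆Δ , refl = ψ ∷ ψs , ψ∈Δ ∷ ψs⊆Δ , refl

∪-compact : ∀ {B : Theory} (P : Formula → Set) → P ⊤' → (∀ {a b} → P a → P b → P (a ∧' b)) →
  B ⊆ P → ∀ {δ} → Γ ∪ B ⊢ δ → Σ[ β ∈ Formula ] (P β × (Γ ⊢ β ⇒ δ))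
∪-compact P P⊤ P∧ B⊆P (assum (inj₁ x)) = ⊤' , P⊤ , ⇒-const (assum x)
∪-compact P P⊤ P∧ B⊆P (assum (inj₂ y)) = _ , B⊆P y , ⇒-refl
∪-compact P P⊤ P∧ B⊆P (thm t)          = ⊤' , P⊤ , ⇒-const (thm t)
∪-compact P P⊤ P∧ B⊆P (mp p q) =
  let β₁ , Pβ₁ , β₁⇒ = ∪-compact P P⊤ P∧ B⊆P p
      β₂ , Pβ₂ , β₂⇒ = ∪-compact P P⊤ P∧ B⊆P q
  in β₁ ∧' β₂ , P∧ Pβ₁ Pβ₂ , ⇒-mp (⇒-trans ∧-elimˡ β₁⇒) (⇒-trans ∧-elimʳ β₂⇒)

module MaximalPair (maximal : Maximal Γ Δ) where

  private
    complete   = proj₁ maximal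
    consistent = proj₂ maximal

  ⋁-∉ : All (_∈ Δ) L → ⋁ L ∉ Γ
  ⋁-∉ L⊆Δ ⋁L∈Γ = consistent (_ , L⊆Δ , assum ⋁L∈Γ)

  ⊢⇒∈ : Γ ⊢ a → a ∈ Γ
  ⊢⇒∈ {a = a} Γ⊢a with complete a
  ... | inj₁ a∈Γ = a∈Γ
  ... | inj₂ a∈Δ with () ← consistent (a ∷ [] , a∈Δ ∷ [] , Γ⊢a)

  ∧-∈⁻ : (a ∧' b) ∈ Γ → a ∈ Γ × b ∈ Γ
  ∧-∈⁻ a∧b∈Γ = ⊢⇒∈ (mp ∧-elimˡ (assum a∧b∈Γ)) , ⊢⇒∈ (mp ∧-elimʳ (assum a∧b∈Γ))

  ∧-∈⁺ : a ∈ Γ × b ∈ Γ → (a ∧' b) ∈ Γ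
  ∧-∈⁺ (a∈Γ , b∈Γ) = ⊢⇒∈ (∧-intro (assum a∈Γ) (assum b∈Γ))

  ∨-∈⁻ : (a ∨' b) ∈ Γ → a ∈ Γ ⊎ b ∈ Γ
  ∨-∈⁻ {a = a} {b = b} a∨b∈Γ with complete a | complete b
  ... | inj₁ a∈Γ | _         = inj₁ a∈Γ
  ... | inj₂ _   | inj₁ b∈Γ  = inj₂ b∈Γ
  ... | inj₂ a∈Δ | inj₂ b∈Δ with () ← ⋁-∉ (a∈Δ ∷ b∈Δ ∷ []) a∨b∈Γ

  ∨-∈⁺ : a ∈ Γ ⊎ b ∈ Γ → (a ∨' b) ∈ Γ
  ∨-∈⁺ (inj₁ a∈Γ) = ⊢⇒∈ (mp (thm (ax-∨I₁ _ _)) (assum a∈Γ))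
  ∨-∈⁺ (inj₂ b∈Γ) = ⊢⇒∈ (mp (thm (ax-∨I₂ _ _)) (assum b∈Γ))

  ⇒-∈-mp : (a ⇒ b) ∈ Γ → a ∈ Γ → b ∈ Γ
  ⇒-∈-mp a⇒b∈Γ a∈Γ = ⊢⇒∈ (mp (assum a⇒b∈Γ) (assum a∈Γ))

  BoxSet-⊤ : ⊤' ∈ BoxSet φ Γ
  BoxSet-⊤ = ⊢⇒∈ (thm (ax-A5 _))

  BoxSet-∧ : a ∈ BoxSet φ Γ → b ∈ BoxSet φ Γ → (a ∧' b) ∈ BoxSet φ Γ
  BoxSet-∧ □a∈Γ □b∈Γ = ⊢⇒∈ (mp (⇔-to (thm (ax-A1 _ _ _))) (∧-intro (assum □a∈Γ) (assum □b∈Γ)))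

  ◇→⋁-∉ : ∀ φ L → All (DiaSet φ Δ) L → (φ ◇→ ⋁ L) ∉ Γ
  ◇→⋁-∉ φ []           []          ◇⊥∈Γ = ⋁-∉ [] (⊢⇒∈ (mp (thm (ax-A6 φ)) (assum ◇⊥∈Γ)))
  ◇→⋁-∉ φ (ψ ∷ [])     (◇ψ∈Δ ∷ []) ◇ψ∈Γ = ⋁-∉ (◇ψ∈Δ ∷ []) ◇ψ∈Γ
  ◇→⋁-∉ φ (ψ ∷ χ ∷ ψs) (◇ψ∈Δ ∷ ◇ψs⊆Δ) ◇⋁∈Γ
    with ∨-∈⁻ (⊢⇒∈ (mp (⇔-to (thm (ax-A3 φ ψ (⋁ (χ ∷ ψs))))) (assum ◇⋁∈Γ)))
  ... | inj₁ ◇ψ∈Γ  = ⋁-∉ (◇ψ∈Δ ∷ []) ◇ψ∈Γ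
  ... | inj₂ ◇ψs∈Γ = ◇→⋁-∉ φ (χ ∷ ψs) ◇ψs⊆Δ ◇ψs∈Γ

BoxSet-extension-consistent : ∀ φ → Maximal Γ Δ → Maximal Γ₁ Δ₁ → Γ₀ ⊆ Γ → DiaImg φ Γ₁ ⊆ Γ₀ →
  Consistent (Γ₁ ∪ BoxSet φ Γ) (DiaSet φ Δ)
BoxSet-extension-consistent {Γ = Γ} φ mΓ mΓ₁ Γ₀⊆Γ ◇Γ₁⊆Γ₀ (L , L⊆◇Δ , ⊢⋁L) =
  let β , □β∈Γ , β⇒⋁L = ∪-compact (BoxSet φ Γ) BoxSet-⊤ BoxSet-∧ (λ x → x) ⊢⋁L

      ◇β⇒⋁L∈Γ : (φ ◇→ (β ⇒ ⋁ L)) ∈ Γ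
      ◇β⇒⋁L∈Γ = Γ₀⊆Γ (◇Γ₁⊆Γ₀ (_ , MaximalPair.⊢⇒∈ mΓ₁ β⇒⋁L , refl))

      ◇[β⇒⋁L∧β] : Γ ⊢ φ ◇→ ((β ⇒ ⋁ L) ∧' β)
      ◇[β⇒⋁L∧β] = mp (thm (ax-A2 _ _ _)) (∧-intro (assum ◇β⇒⋁L∈Γ) (assum □β∈Γ))
  in ◇→⋁-∉ φ L L⊆◇Δ (⊢⇒∈ (mp (◇→-mono (∅⊢⇒Thm (⇒-mp ∧-elimˡ ∧-elimʳ))) ◇[β⇒⋁L∧β]))
  where open MaximalPair mΓ

DiaImg-extension-consistent : ∀ φ → Maximal Γ Δ → Maximal Γ₀ Δ₀ → Γ₁ ⊆ Γ → BoxSet φ Γ₀ ⊆ Γ₁ →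
  Consistent (Γ₀ ∪ DiaImg φ Γ) (BoxImg φ Δ)
DiaImg-extension-consistent {Γ = Γ} {Γ₀ = Γ₀} φ mΓ mΓ₀ Γ₁⊆Γ □Γ₀⊆Γ₁ (L , L⊆□Δ , ⊢⋁L)
  with All-BoxImg L⊆□Δ
... | ψs , ψs⊆Δ , refl =
  let _ , (χ , χ∈Γ , ◇χ⇒β) , β⇒⋁L = ∪-compact ◇-implied ◇-implied-⊤ ◇-implied-∧ DiaImg⊆◇-implied ⊢⋁L

      □χ⇒⋁ψs∈Γ₀ : (φ □→ (χ ⇒ ⋁ ψs)) ∈ Γ₀
      □χ⇒⋁ψs∈Γ₀ = MaximalPair.⊢⇒∈ mΓ₀
        (mp (thm (ax-A4 _ _ _)) (⇒-trans ◇χ⇒β (⇒-trans β⇒⋁L (thm (⋁-□→ φ ψs)))))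
  in ⋁-∉ ψs⊆Δ (⇒-∈-mp (Γ₁⊆Γ (□Γ₀⊆Γ₁ □χ⇒⋁ψs∈Γ₀)) χ∈Γ)
  where
    open MaximalPair mΓ

    ◇-implied : Formula → Set
    ◇-implied β = Σ[ χ ∈ Formula ] (χ ∈ Γ × (Γ₀ ⊢ (φ ◇→ χ) ⇒ β))

    ◇-implied-⊤ : ◇-implied ⊤'
    ◇-implied-⊤ = ⊤' , ⊢⇒∈ (thm ax-⊤) , ⇒-const (thm ax-⊤)

    ◇-implied-∧ : ∀ {a b} → ◇-implied a → ◇-implied b → ◇-implied (a ∧' b)
    ◇-implied-∧ (χ₁ , χ₁∈Γ , ◇χ₁⇒a) (χ₂ , χ₂∈Γ , ◇χ₂⇒b) =
      χ₁ ∧' χ₂ , ∧-∈⁺ (χ₁∈Γ , χ₂∈Γ) ,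
      ⇒-∧-intro (⇒-trans (◇→-mono (∅⊢⇒Thm ∧-elimˡ)) ◇χ₁⇒a) (⇒-trans (◇→-mono (∅⊢⇒Thm ∧-elimʳ)) ◇χ₂⇒b)

    DiaImg⊆◇-implied : DiaImg φ Γ ⊆ ◇-implied
    DiaImg⊆◇-implied (χ , χ∈Γ , refl) = χ , χ∈Γ , ⇒-refl

lemma7 : ∀ (Γ Δ Γ₀ Δ₀ Γ₁ Δ₁ : Theory) → Maximal Γ Δ → Maximal Γ₀ Δ₀ → Maximal Γ₁ Δ₁ →
    ∀ (φ ψ : Formula) →
      ((Γ ⊢ φ) → φ ∈ Γ)
      × (((φ ∧' ψ) ∈ Γ → φ ∈ Γ × ψ ∈ Γ) × (φ ∈ Γ × ψ ∈ Γ → (φ ∧' ψ) ∈ Γ))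
      × (((φ ∨' ψ) ∈ Γ → φ ∈ Γ ⊎ ψ ∈ Γ) × (φ ∈ Γ ⊎ ψ ∈ Γ → (φ ∨' ψ) ∈ Γ))
      × ((φ ⇒ ψ) ∈ Γ → φ ∈ Γ → ψ ∈ Γ)
      × (Γ₀ ⊆ Γ → BoxSet φ Γ₀ ⊆ Γ₁ → DiaImg φ Γ₁ ⊆ Γ₀ →
          Consistent (Γ₁ ∪ BoxSet φ Γ) (DiaSet φ Δ))
      × (Γ₁ ⊆ Γ → BoxSet φ Γ₀ ⊆ Γ₁ → DiaImg φ Γ₁ ⊆ Γ₀ →
          Consistent (Γ₀ ∪ DiaImg φ Γ) (BoxImg φ Δ))
lemma7 Γ Δ Γ₀ Δ₀ Γ₁ Δ₁ mΓ mΓ₀ mΓ₁ φ ψ =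
  ⊢⇒∈ ,
  (∧-∈⁻ , ∧-∈⁺) ,
  (∨-∈⁻ , ∨-∈⁺) ,
  ⇒-∈-mp ,
  (λ Γ₀⊆Γ _ ◇Γ₁⊆Γ₀ → BoxSet-extension-consistent φ mΓ mΓ₁ Γ₀⊆Γ ◇Γ₁⊆Γ₀) ,
  (λ Γ₁⊆Γ □Γ₀⊆Γ₁ _ → DiaImg-extension-consistent φ mΓ mΓ₀ Γ₁⊆Γ □Γ₀⊆Γ₁)
  where open MaximalPair mΓ
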